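{- Let $G$ and $H$ be terminating impartial games. Then $G\simeq_1 H$ if and only if $o(S\odot_i G_i)=o(S\odot_i H_i)$ for every poset $S$, every index $i_0\in S$ and all families of games $(G_i)_{i\in S}$, $(H_i)_{i\in S}$ with $G_{i_0}=G$, $H_{i_0}=H$ and $G_i=H_i$ for all $i\neq i_0$, such that both ordered joins $S\odot_i G_i$ and $S\odot_i H_i$ are terminating.
   Context: All games are impartial combinatorial games under normal play (a player unable to move loses); a game is determined by its set of options, $G\to G'$ means $G'$ is an option of $G$, $G=H$ means the games are identical, and $\mathbf{0}$ is the empty game. A game is terminating if it admits no infinite sequence of moves; $o(G)$ denotes the outcome class of a terminating game (whether the player to move or the other player wins). The Grundy number is $\Gamma_0(G)=\operatorname{mex}\{\Gamma_0(G') : G\to G'\}$ (least excluded ordinal), the Grundy set is $\Gamma_1(G)=\{\Gamma_0(G') : G\to G'\}$, and $G\simeq_1 H$ means $\Gamma_1(G)=\Gamma_1(H)$. Ordered join: for a poset $S$ and games $(G_i)_{i\in S}$, $S \odot_i G_i$ is the game whose options are exactly the ordered joins $S \odot_i G'_i$ such that for one index $i_0\in S$, $G_{i_0}\to G'_{i_0}$, $G'_i=\mathbf{0}$ for all $i>i_0$, and $G'_i=G_i$ for all other $i$. -}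

module Defs where

open import Level using (Level; _⊔_; 0ℓ) renaming (suc to lsuc)
open import Data.Empty using (⊥)
open import Data.Product using (Σ; _×_; _,_)
open import Relation.Nullary using (¬_)
open import Relation.Binary.Core using (Rel)
open import Relation.Binary.PropositionalEquality using (_≡_; _≢_)
open import Induction.WellFounded using (Acc)

-- Terminating impartial games: well-founded trees whose options are
-- indexed by an arbitrary type in Set.  (Every terminating game is of
-- this form; termination is built in.)

data Game : Set₁ where
  mk : (I : Set) → (I → Game) → Game

Opt : Game → Set
Opt (mk I _) = I

opt : (G : Game) → Opt G → Game
opt (mk _ g) = g

𝟎 : Game
𝟎 = mk ⊥ (λ ())

-- Ordinals (extensional well-founded trees ordered by rank):
-- the tree  lim I f  denotes the ordinal  sup { f i + 1 }.

data Ord : Set₁ where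
  lim : (I : Set) → (I → Ord) → Ord

mutual
  _≤o_ : Ord → Ord → Set
  lim I f ≤o β = ∀ i → f i <o β

  _<o_ : Ord → Ord → Set
  α <o lim J g = Σ J λ j → α ≤o g j

_≈o_ : Ord → Ord → Set
α ≈o β = (α ≤o β) × (β ≤o α)

IsMex : {I : Set} → (I → Ord) → Ord → Set₁
IsMex {I} v α = (∀ i → ¬ (v i ≈o α)) × (∀ β → β <o α → Σ I λ i → v i ≈o β)

data IsGrundy : Game → Ord → Set₁ where
  grundy : {I : Set} {g : I → Game} {α : Ord} (v : I → Ord) →
           (∀ i → IsGrundy (g i) (v i)) → IsMex v α → IsGrundy (mk I g) α

SameΓ₀ : Game → Game → Set₁
SameΓ₀ A B = Σ Ord λ α → IsGrundy A α × IsGrundy B α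

-- G ≃₁ H  :  Γ₁(G) = Γ₁(H)  (equality of the sets of Grundy numbers of options)
_≃₁_ : Game → Game → Set₁
G ≃₁ H = (∀ i → Σ (Opt H) λ j → SameΓ₀ (opt G i) (opt H j))
       × (∀ j → Σ (Opt G) λ i → SameΓ₀ (opt G i) (opt H j))

module _ {a ℓ : Level} {A : Set a} (_⇒_ : A → A → Set ℓ) where

  mutual
    data Lose : A → Set (a ⊔ ℓ) where
      lose : ∀ {x} → (∀ y → x ⇒ y → Win y) → Lose x

    data Win : A → Set (a ⊔ ℓ) where
      win : ∀ {x} y → x ⇒ y → Lose y → Win x

  Terminating : A → Set (a ⊔ ℓ)
  Terminating = Acc (λ y x → x ⇒ y)

  SameOutcome : A → A → Set (a ⊔ ℓ)
  SameOutcome x y = ((Lose x → Lose y) × (Lose y → Lose x))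
                  × ((Win x → Win y) × (Win y → Win x))

module _ {S : Set} (_≤_ : Rel S 0ℓ) where

  _<ₛ_ : S → S → Set
  i <ₛ j = (i ≤ j) × (i ≢ j)

  JoinMove : (S → Game) → (S → Game) → Set₁
  JoinMove F F' = Σ S λ i₀ → Σ (Opt (F i₀)) λ j →
      (F' i₀ ≡ opt (F i₀) j)
    × (∀ i → i₀ <ₛ i → F' i ≡ 𝟎)
    × (∀ i → i ≢ i₀ → ¬ (i₀ <ₛ i) → F' i ≡ F i)

{-# OPTIONS --safe #-}
module Submission where

open import Defs
open import Level using (_⊔_; 0ℓ; lift) renaming (suc to lsuc)
import Level
open import Axiom.ExcludedMiddle using (ExcludedMiddle)
open import Function.Bundles using (_⇔_; mk⇔)
open import Data.Empty using (⊥; ⊥-elim)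
open import Data.Product using (Σ; _×_; _,_; proj₁; proj₂; swap)
open import Data.Sum using (_⊎_; inj₁; inj₂; [_,_])
open import Relation.Nullary using (¬_; Dec; yes; no)
open import Relation.Nullary.Decidable using (True; toWitness; fromWitness; map′; decidable-stable)
open import Relation.Binary.Core using (Rel)
open import Relation.Binary.Definitions using (Decidable; DecidableEquality)
open import Relation.Binary.Structures using (IsPartialOrder)
open import Relation.Binary.PropositionalEquality
  using (_≡_; _≢_; refl; sym; trans; subst; subst₂; isEquivalence)
open import Induction.WellFounded using (Acc; acc; WellFounded)

-- A copycat strategy proves the forward direction: play the same move in the
-- other game, except that a move inside the i₀-component is answered by an
-- option of equal Grundy value (which exists since Γ₁(G) = Γ₁(H)), or is
-- reversed once only the Grundy value of that component matters.  For the
-- converse, suppose some option G' of G has a Grundy value α ∉ Γ₁(H).  We build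
-- a game Y such that the ordered join of H below Y has Grundy value α; then the
-- join over the poset {lower < upper, aside} with Gs = (G, Y, G') and
-- Hs = (H, Y, G') separates G from H: it is a sum of two games of equal Grundy
-- value on the H side, but not on the G side.

-- Ordinals

≤o-refl : ∀ α → α ≤o α
≤o-refl (lim I f) i = i , ≤o-refl (f i)

mutual
  ≤o-trans : ∀ {α β γ} → α ≤o β → β ≤o γ → α ≤o γ
  ≤o-trans {lim I f} α≤β β≤γ i = <o-≤o-trans (α≤β i) β≤γ

  <o-≤o-trans : ∀ {α β γ} → α <o β → β ≤o γ → α <o γ
  <o-≤o-trans {β = lim J g} (j , α≤gj) β≤γ = ≤o-<o-trans α≤gj (β≤γ j)

  ≤o-<o-trans : ∀ {α β γ} → α ≤o β → β <o γ → α <o γ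
  ≤o-<o-trans {γ = lim K h} α≤β (k , β≤hk) = k , ≤o-trans α≤β β≤hk

<o-irrefl : ∀ {α} → ¬ (α <o α)
<o-irrefl {lim I f} (i , fi<α) = <o-irrefl (fi<α i)

≈o-refl : ∀ {α} → α ≈o α
≈o-refl {α} = ≤o-refl α , ≤o-refl α

≈o-sym : ∀ {α β} → α ≈o β → β ≈o α
≈o-sym = swap

≈o-trans : ∀ {α β γ} → α ≈o β → β ≈o γ → α ≈o γ
≈o-trans (α≤β , β≤α) (β≤γ , γ≤β) = ≤o-trans α≤β β≤γ , ≤o-trans γ≤β β≤α

<o-wellFounded : WellFounded _<o_
<o-wellFounded α = acc-≤o α (≤o-refl α)
  where
    acc-≤o : ∀ α {β} → β ≤o α → Acc _<o_ β
    acc-≤o (lim I f) β≤α = acc λ γ<β →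
      let (i , γ≤fi) = <o-≤o-trans γ<β β≤α in acc-≤o (f i) γ≤fi

-- Grundy values

IsGrundy-resp-≈o : ∀ {G α β} → IsGrundy G α → α ≈o β → IsGrundy G β
IsGrundy-resp-≈o (grundy v dv (∉ , ∈)) (α≤β , β≤α) =
  grundy v dv ((λ i e → ∉ i (≈o-trans e (β≤α , α≤β))) , λ γ γ<β → ∈ γ (<o-≤o-trans γ<β β≤α))

grundy-inv : ∀ {G α} → IsGrundy G α →
  Σ (Opt G → Ord) λ v → (∀ i → IsGrundy (opt G i) (v i)) × IsMex v α
grundy-inv (grundy v dv mex) = v , dv , mex

SameΓ₀-sym : ∀ {A B} → SameΓ₀ A B → SameΓ₀ B A
SameΓ₀-sym (α , dA , dB) = α , dB , dA

≃₁-sym : ∀ {A B} → A ≃₁ B → B ≃₁ A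
≃₁-sym (A⊆B , B⊆A) =
  (λ j → let (i , s) = B⊆A j in i , SameΓ₀-sym s) , (λ i → let (j , s) = A⊆B i in j , SameΓ₀-sym s)

𝟎≃₁𝟎 : 𝟎 ≃₁ 𝟎
𝟎≃₁𝟎 = (λ ()) , (λ ())

module Classical (em : ExcludedMiddle (lsuc 0ℓ)) where

  stable₁ : {P : Set₁} → ¬ ¬ P → P
  stable₁ = decidable-stable em

  decide₀ : (P : Set) → Dec P
  decide₀ P = map′ Level.lower lift em

  stable₀ : {P : Set} → ¬ ¬ P → P
  stable₀ = decidable-stable (decide₀ _)

  mutual
    ≰o⇒>o : ∀ {α β} → ¬ (α ≤o β) → β <o α
    ≰o⇒>o {lim I f} {β} α≰β =
      let (i , fi≮β) = stable₀ λ ∄ → α≰β λ i → stable₀ λ fi≮β → ∄ (i , fi≮β)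
      in i , ≮o⇒≥o fi≮β

    ≮o⇒≥o : ∀ {α β} → ¬ (α <o β) → β ≤o α
    ≮o⇒≥o {β = lim J g} α≮β j = ≰o⇒>o λ α≤gj → α≮β (j , α≤gj)

  compare : ∀ α β → α <o β ⊎ α ≈o β ⊎ β <o α
  compare α β with decide₀ (α ≤o β) | decide₀ (β ≤o α)
  ... | no α≰β | _ = inj₂ (inj₂ (≰o⇒>o α≰β))
  ... | yes α≤β | yes β≤α = inj₂ (inj₁ (α≤β , β≤α))
  ... | yes _ | no β≰α = inj₁ (≰o⇒>o β≰α)

  mex-exists : {I : Set} (v : I → Ord) → Σ Ord (IsMex v)
  mex-exists {I} v = least-unhit (lim I v) (<o-wellFounded _) lim-unhit
    where
      Hit : Ord → Set
      Hit β = Σ I λ i → v i ≈o β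

      lim-unhit : ¬ Hit (lim I v)
      lim-unhit (i , (_ , lim≤vi)) = <o-irrefl (<o-≤o-trans (i , ≤o-refl (v i)) lim≤vi)

      least-unhit : ∀ β → Acc _<o_ β → ¬ Hit β → Σ Ord (IsMex v)
      least-unhit β (acc rs) β-unhit with em {Σ Ord λ γ → γ <o β × ¬ Hit γ}
      ... | yes (γ , γ<β , γ-unhit) = least-unhit γ (rs γ<β) γ-unhit
      ... | no ∄ = β , (λ i e → β-unhit (i , e)) , λ γ γ<β → stable₀ λ γ-unhit → ∄ (γ , γ<β , γ-unhit)

  grundy-exists : (G : Game) → Σ Ord (IsGrundy G)
  grundy-exists (mk I g) =
    let (α , mex) = mex-exists (λ i → proj₁ (grundy-exists (g i)))
    in α , grundy _ (λ i → proj₂ (grundy-exists (g i))) mex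

  Γ₀ : Game → Ord
  Γ₀ G = proj₁ (grundy-exists G)

  Γ₀-isGrundy : ∀ G → IsGrundy G (Γ₀ G)
  Γ₀-isGrundy G = proj₂ (grundy-exists G)

  mex-unique : {I : Set} {v v' : I → Ord} {α β : Ord} →
    (∀ i → v i ≈o v' i) → IsMex v α → IsMex v' β → α ≈o β
  mex-unique {α = α} {β} v≈v' (∉ , ∈) (∉' , ∈') with compare α β
  ... | inj₁ α<β = let (i , e) = ∈' α α<β in ⊥-elim (∉ i (≈o-trans (v≈v' i) e))
  ... | inj₂ (inj₁ α≈β) = α≈β
  ... | inj₂ (inj₂ β<α) = let (i , e) = ∈ β β<α in ⊥-elim (∉' i (≈o-trans (≈o-sym (v≈v' i)) e))

  IsGrundy-unique : ∀ {G α β} → IsGrundy G α → IsGrundy G β → α ≈o β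
  IsGrundy-unique (grundy v dv mex) (grundy v' dv' mex') =
    mex-unique (λ i → IsGrundy-unique (dv i) (dv' i)) mex mex'

-- Outcomes

lose⇒¬win : ∀ {a ℓ} {A : Set a} {_⇒_ : A → A → Set ℓ} {x} → Lose _⇒_ x → ¬ Win _⇒_ x
lose⇒¬win (lose h) (win y x⇒y y-loses) = lose⇒¬win y-loses (h y x⇒y)

module Transfer {a ℓ r} {A : Set a} (_⇒_ : A → A → Set ℓ) (_∼_ : A → A → Set r) where

  -- x answers y's move to y' either by a move of its own, or by a move
  -- from y' that reverses it.
  Answer : A → A → A → Set (a ⊔ ℓ ⊔ r)
  Answer x y y' = (Σ A λ x' → x ⇒ x' × x' ∼ y') ⊎ (Σ A λ y'' → y' ⇒ y'' × x ∼ y'')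

  module _ (∼-sym : ∀ {x y} → x ∼ y → y ∼ x)
           (answer : ∀ {x y y'} → x ∼ y → y ⇒ y' → Answer x y y') where

    mutual
      Lose-transfer : ∀ {x y} → x ∼ y → Terminating _⇒_ y → Lose _⇒_ x → Lose _⇒_ y
      Lose-transfer {y = y} x∼y (acc rs) x-loses =
        lose λ y' y⇒y' → Lose-answered {y = y} x-loses (rs y⇒y') (answer x∼y y⇒y')

      Lose-answered : ∀ {x y y'} → Lose _⇒_ x → Terminating _⇒_ y' → Answer x y y' → Win _⇒_ y'
      Lose-answered (lose h) t (inj₁ (x' , x⇒x' , x'∼y')) = Win-transfer x'∼y' t (h x' x⇒x')
      Lose-answered x-loses (acc rs) (inj₂ (y'' , y'⇒y'' , x∼y'')) =
        win y'' y'⇒y'' (Lose-transfer x∼y'' (rs y'⇒y'') x-loses)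

      Win-transfer : ∀ {x y} → x ∼ y → Terminating _⇒_ y → Win _⇒_ x → Win _⇒_ y
      Win-transfer {x = x} x∼y t (win x' x⇒x' x'-loses) = Win-answered {x = x} t x'-loses (answer (∼-sym x∼y) x⇒x')

      Win-answered : ∀ {x y x'} → Terminating _⇒_ y → Lose _⇒_ x' → Answer y x x' → Win _⇒_ y
      Win-answered (acc rs) x'-loses (inj₁ (y' , y⇒y' , y'∼x')) =
        win y' y⇒y' (Lose-transfer (∼-sym y'∼x') (rs y⇒y') x'-loses)
      Win-answered t (lose h) (inj₂ (x'' , x'⇒x'' , y∼x'')) = Win-transfer (∼-sym y∼x'') t (h x'' x'⇒x'')

    same-outcome : ∀ {x y} → x ∼ y → Terminating _⇒_ x → Terminating _⇒_ y → SameOutcome _⇒_ x y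
    same-outcome x∼y tx ty =
      (Lose-transfer x∼y ty , Lose-transfer (∼-sym x∼y) tx) , (Win-transfer x∼y ty , Win-transfer (∼-sym x∼y) tx)

-- Positions of an ordered join

module JoinPositions {S : Set} (_≤_ : Rel S 0ℓ) where

  Position : Set₁
  Position = S → Game

  _⇒_ : Position → Position → Set₁
  _⇒_ = JoinMove _≤_

  _<_ : S → S → Set
  _<_ = _<ₛ_ _≤_

  -- Positions are functions, so without function extensionality pointwise
  -- equal positions have to be related explicitly.
  _≐_ : Position → Position → Set₁
  F ≐ F' = ∀ i → F i ≡ F' i

  ≐-sym : ∀ {F F'} → F ≐ F' → F' ≐ F
  ≐-sym F≐F' i = sym (F≐F' i)

  opt-subst : ∀ {A B} (A≡B : A ≡ B) (j : Opt B) → opt A (subst Opt (sym A≡B) j) ≡ opt B j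
  opt-subst refl j = refl

  ⇒-respˡ-≐ : ∀ {F F' F''} → F ≐ F' → F' ⇒ F'' → F ⇒ F''
  ⇒-respˡ-≐ F≐F' (i₀ , j , at-i₀ , above , other) =
    i₀ , subst Opt (sym (F≐F' i₀)) j , trans at-i₀ (sym (opt-subst (F≐F' i₀) j)) , above ,
    λ i i≢i₀ i₀≮i → trans (other i i≢i₀ i₀≮i) (sym (F≐F' i))

  Win-resp-≐ : ∀ {F F'} → F ≐ F' → Win _⇒_ F → Win _⇒_ F'
  Win-resp-≐ F≐F' (win F'' F⇒F'' F''-loses) = win F'' (⇒-respˡ-≐ (≐-sym F≐F') F⇒F'') F''-loses

  Terminating-resp-≐ : ∀ {F F'} → F ≐ F' → Terminating _⇒_ F → Terminating _⇒_ F'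
  Terminating-resp-≐ F≐F' (acc rs) = acc λ F'⇒F'' → rs (⇒-respˡ-≐ F≐F' F'⇒F'')

  module Play (_≟_ : DecidableEquality S) (_<?_ : Decidable _<_) where

    play : S → Position → Game → Position
    play i₀ F X i with i ≟ i₀ | i₀ <? i
    ... | yes _ | _ = X
    ... | no _ | yes _ = 𝟎
    ... | no _ | no _ = F i

    play-at : ∀ {i₀ F X} → play i₀ F X i₀ ≡ X
    play-at {i₀} with i₀ ≟ i₀ | i₀ <? i₀
    ... | yes _ | _ = refl
    ... | no i₀≢i₀ | _ = ⊥-elim (i₀≢i₀ refl)

    play-above : ∀ {i₀ F X i} → i₀ < i → play i₀ F X i ≡ 𝟎
    play-above {i₀} {i = i} i₀<i with i ≟ i₀ | i₀ <? i
    ... | yes i≡i₀ | _ = ⊥-elim (proj₂ i₀<i (sym i≡i₀))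
    ... | no _ | yes _ = refl
    ... | no _ | no i₀≮i = ⊥-elim (i₀≮i i₀<i)

    play-other : ∀ {i₀ F X i} → i ≢ i₀ → ¬ i₀ < i → play i₀ F X i ≡ F i
    play-other {i₀} {i = i} i≢i₀ i₀≮i with i ≟ i₀ | i₀ <? i
    ... | yes i≡i₀ | _ = ⊥-elim (i≢i₀ i≡i₀)
    ... | no _ | yes i₀<i = ⊥-elim (i₀≮i i₀<i)
    ... | no _ | no _ = refl

    move-play : ∀ {F i₀ X} → F i₀ ≡ X → (j : Opt X) → F ⇒ play i₀ F (opt X j)
    move-play refl j = _ , j , play-at , (λ _ → play-above) , (λ _ → play-other)

    ⇒-play : ∀ {F F'} → F ⇒ F' → Σ S λ i₀ → Σ (Opt (F i₀)) λ j → F' ≐ play i₀ F (opt (F i₀) j)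
    ⇒-play {F} {F'} (i₀ , j , at-i₀ , above , other) = i₀ , j , pointwise
      where
        pointwise : F' ≐ play i₀ F (opt (F i₀) j)
        pointwise i with i ≟ i₀ | i₀ <? i
        ... | yes refl | _ = at-i₀
        ... | no _ | yes i₀<i = above i i₀<i
        ... | no i≢i₀ | no i₀≮i = other i i≢i₀ i₀≮i

    AgreeOff : S → Position → Position → Set₁
    AgreeOff k F F' = ∀ i → i ≢ k → F i ≡ F' i

    ZeroAbove : S → Position → Set₁
    ZeroAbove k F = ∀ i → k < i → F i ≡ 𝟎

    AgreeOff-play : ∀ {k i₀ F F' X X'} → AgreeOff k F F' → (i₀ ≢ k → X ≡ X') →
      AgreeOff k (play i₀ F X) (play i₀ F' X')
    AgreeOff-play {i₀ = i₀} agree X≡X' i i≢k with i ≟ i₀ | i₀ <? i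
    ... | yes refl | _ = X≡X' i≢k
    ... | no _ | yes _ = refl
    ... | no _ | no _ = agree i i≢k

    AgreeOff-playʳ : ∀ {k F F' X} → ZeroAbove k F → AgreeOff k F F' → AgreeOff k F (play k F' X)
    AgreeOff-playʳ {k} zero agree i i≢k with i ≟ k | k <? i
    ... | yes i≡k | _ = ⊥-elim (i≢k i≡k)
    ... | no _ | yes k<i = zero i k<i
    ... | no _ | no _ = agree i i≢k

    ZeroAbove-play : ∀ {k i₀ F X} → ZeroAbove k F → ¬ k < i₀ → ZeroAbove k (play i₀ F X)
    ZeroAbove-play {i₀ = i₀} zero k≮i₀ i k<i with i ≟ i₀ | i₀ <? i
    ... | yes refl | _ = ⊥-elim (k≮i₀ k<i)
    ... | no _ | yes _ = refl
    ... | no _ | no _ = zero i k<i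

module Copycat (em : ExcludedMiddle (lsuc 0ℓ)) {S : Set} (_≤_ : Rel S 0ℓ) (k : S) where
  open Classical em
  open JoinPositions _≤_

  _≟_ : DecidableEquality S
  i ≟ j = decide₀ (i ≡ j)

  open Play _≟_ (λ i j → decide₀ (i < j))

  -- The second case is reached once a move in the k-component has been copied
  -- by an option of the same Grundy value; from then on nothing above k is
  -- left, so only that Grundy value matters.
  data Linked (F F' : Position) : Set₁ where
    by-≃₁ : F k ≃₁ F' k → Linked F F'
    by-Γ₀ : SameΓ₀ (F k) (F' k) → ZeroAbove k F → ZeroAbove k F' → Linked F F'

  _∼_ : Position → Position → Set₁
  F ∼ F' = AgreeOff k F F' × Linked F F'

  ∼-sym : ∀ {F F'} → F ∼ F' → F' ∼ F
  ∼-sym {F} {F'} (agree , by-≃₁ c) = (λ i i≢k → sym (agree i i≢k)) , by-≃₁ (≃₁-sym {F k} {F' k} c)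
  ∼-sym (agree , by-Γ₀ s zero zero') = (λ i i≢k → sym (agree i i≢k)) , by-Γ₀ (SameΓ₀-sym s) zero' zero

  ∼-respʳ-≐ : ∀ {F F' F''} → F ∼ F' → F' ≐ F'' → F ∼ F''
  ∼-respʳ-≐ {F} (agree , by-≃₁ c) F'≐F'' =
    (λ i i≢k → trans (agree i i≢k) (F'≐F'' i)) , by-≃₁ (subst (F k ≃₁_) (F'≐F'' k) c)
  ∼-respʳ-≐ {F} (agree , by-Γ₀ s zero zero') F'≐F'' =
    (λ i i≢k → trans (agree i i≢k) (F'≐F'' i)) ,
    by-Γ₀ (subst (SameΓ₀ (F k)) (F'≐F'' k) s) zero (λ i k<i → trans (sym (F'≐F'' i)) (zero' i k<i))

  open Transfer _⇒_ _∼_ using (Answer; same-outcome)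

  Answer-resp-≐ : ∀ {F F' F'' P} → F'' ≐ P → Answer F F' P → Answer F F' F''
  Answer-resp-≐ F''≐P (inj₁ (F₃ , F⇒F₃ , F₃∼P)) = inj₁ (F₃ , F⇒F₃ , ∼-respʳ-≐ F₃∼P (≐-sym F''≐P))
  Answer-resp-≐ F''≐P (inj₂ (F₄ , P⇒F₄ , F∼F₄)) = inj₂ (F₄ , ⇒-respˡ-≐ F''≐P P⇒F₄ , F∼F₄)

  copy-at-k : ∀ {F F' X'} → AgreeOff k F F' → (i : Opt (F k)) → SameΓ₀ (opt (F k) i) X' →
    Σ Position λ F₃ → F ⇒ F₃ × F₃ ∼ play k F' X'
  copy-at-k agree i s =
    _ , move-play refl i ,
    AgreeOff-play agree (λ k≢k → ⊥-elim (k≢k refl)) ,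
    by-Γ₀ (subst₂ SameΓ₀ (sym play-at) (sym play-at) s) (λ _ → play-above) (λ _ → play-above)

  answer-at-k : ∀ {F F'} → F ∼ F' → (j : Opt (F' k)) → Answer F F' (play k F' (opt (F' k) j))
  answer-at-k (agree , by-≃₁ c) j = let (i , s) = proj₂ c j in inj₁ (copy-at-k agree i s)
  answer-at-k (agree , by-Γ₀ (α , dF , dF') zero zero') j
    with grundy-inv dF | grundy-inv dF'
  ... | v , dv , (_ , ∈) | v' , dv' , (∉' , _) with compare (v' j) α
  ... | inj₁ v'j<α =
    let (i , e) = ∈ (v' j) v'j<α in inj₁ (copy-at-k agree i (v' j , IsGrundy-resp-≈o (dv i) e , dv' j))
  ... | inj₂ (inj₁ v'j≈α) = ⊥-elim (∉' j v'j≈α)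
  ... | inj₂ (inj₂ α<v'j) =
    let (w , dw , (_ , ∈ʲ)) = grundy-inv (dv' j)
        (l , e) = ∈ʲ α α<v'j
    in inj₂ (_ , move-play play-at l ,
             AgreeOff-playʳ zero (AgreeOff-playʳ zero agree) ,
             by-Γ₀ (α , dF , subst (λ G → IsGrundy G α) (sym play-at) (IsGrundy-resp-≈o (dw l) e))
                   zero (λ _ → play-above))

  copy-off-k : ∀ {F F' i₀} → F ∼ F' → i₀ ≢ k → (j : Opt (F' i₀)) →
    play i₀ F (opt (F' i₀) j) ∼ play i₀ F' (opt (F' i₀) j)
  copy-off-k {F} {F'} {i₀} (agree , linked) i₀≢k j = AgreeOff-play agree (λ _ → refl) , linked-after (decide₀ (i₀ < k)) linked
    where
      k≢i₀ : k ≢ i₀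
      k≢i₀ k≡i₀ = i₀≢k (sym k≡i₀)

      linked-after : Dec (i₀ < k) → Linked F F' → Linked (play i₀ F (opt (F' i₀) j)) (play i₀ F' (opt (F' i₀) j))
      linked-after (yes i₀<k) _ = by-≃₁ (subst₂ _≃₁_ (sym (play-above i₀<k)) (sym (play-above i₀<k)) 𝟎≃₁𝟎)
      linked-after (no i₀≮k) (by-≃₁ c) = by-≃₁ (subst₂ _≃₁_ (sym (play-other k≢i₀ i₀≮k)) (sym (play-other k≢i₀ i₀≮k)) c)
      linked-after (no i₀≮k) (by-Γ₀ s zero zero') =
        by-Γ₀ (subst₂ SameΓ₀ (sym (play-other k≢i₀ i₀≮k)) (sym (play-other k≢i₀ i₀≮k)) s)
              (ZeroAbove-play zero k≮i₀) (ZeroAbove-play zero' k≮i₀)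
        where
          k≮i₀ : ¬ k < i₀
          k≮i₀ k<i₀ = subst Opt (zero' i₀ k<i₀) j

  answer : ∀ {F F' F''} → F ∼ F' → F' ⇒ F'' → Answer F F' F''
  answer {F} {F'} F∼F' F'⇒F'' with ⇒-play F'⇒F''
  ... | i₀ , j , F''≐ = Answer-resp-≐ {F} {F'} F''≐ (answer-play i₀ j)
    where
      answer-play : ∀ i₀ (j : Opt (F' i₀)) → Answer F F' (play i₀ F' (opt (F' i₀) j))
      answer-play i₀ j with i₀ ≟ k
      ... | yes refl = answer-at-k F∼F' j
      ... | no i₀≢k = inj₁ (_ , move-play (proj₁ F∼F' i₀ i₀≢k) j , copy-off-k F∼F' i₀≢k j)

  ∼⇒same-outcome : ∀ {F F'} → F ∼ F' → Terminating _⇒_ F → Terminating _⇒_ F' → SameOutcome _⇒_ F F'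
  ∼⇒same-outcome = same-outcome ∼-sym answer

≃₁⇒same-outcome : ExcludedMiddle (lsuc 0ℓ) → ∀ {S : Set} (_≤_ : Rel S 0ℓ) (i₀ : S) {Gs Hs : S → Game} →
  Gs i₀ ≃₁ Hs i₀ → (∀ i → i ≢ i₀ → Gs i ≡ Hs i) →
  Terminating (JoinMove _≤_) Gs → Terminating (JoinMove _≤_) Hs → SameOutcome (JoinMove _≤_) Gs Hs
≃₁⇒same-outcome em _≤_ i₀ c agree = ∼⇒same-outcome (agree , by-≃₁ c)
  where open Copycat em _≤_ i₀

-- A separating ordered join

-- The poset lower < upper together with an incomparable element aside: its
-- ordered join is the disjunctive sum of a join over a two-element chain and
-- the aside component.
data Three : Set where
  lower upper aside : Three

data _≤₃_ : Three → Three → Set where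
  lower≤lower : lower ≤₃ lower
  lower≤upper : lower ≤₃ upper
  upper≤upper : upper ≤₃ upper
  aside≤aside : aside ≤₃ aside

≤₃-isPartialOrder : IsPartialOrder _≡_ _≤₃_
≤₃-isPartialOrder = record
  { isPreorder = record
    { isEquivalence = isEquivalence
    ; reflexive = λ { {lower} refl → lower≤lower ; {upper} refl → upper≤upper ; {aside} refl → aside≤aside }
    ; trans = λ { lower≤lower q → q ; lower≤upper upper≤upper → lower≤upper
                ; upper≤upper upper≤upper → upper≤upper ; aside≤aside aside≤aside → aside≤aside } }
  ; antisym = λ { lower≤lower _ → refl ; upper≤upper _ → refl ; aside≤aside _ → refl ; lower≤upper () } }

open JoinPositions _≤₃_ using (_≐_; ≐-sym; Win-resp-≐; Terminating-resp-≐)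
  renaming (_⇒_ to _⇒₃_)

three : Game → Game → Game → Three → Game
three X Y Z lower = X
three X Y Z upper = Y
three X Y Z aside = Z

-- The ordered join over the chain x < y with Gx = X and Gy = Y.
Chain : Game → Game → Game
Chain (mk I f) (mk K g) = mk (I ⊎ K) [ (λ i → Chain (f i) 𝟎) , (λ j → Chain (mk I f) (g j)) ]

Chain-𝟎 : ∀ {X α} → IsGrundy X α → IsGrundy (Chain X 𝟎) α
Chain-𝟎 (grundy v dv (∉ , ∈)) =
  grundy (λ { (inj₁ i) → v i ; (inj₂ ()) }) (λ { (inj₁ i) → Chain-𝟎 (dv i) ; (inj₂ ()) })
         ((λ { (inj₁ i) → ∉ i ; (inj₂ ()) }) , λ β β<α → let (i , e) = ∈ β β<α in inj₁ i , e)

data ThreeMove (X Y Z : Game) (F : Three → Game) : Set₁ where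
  at-lower : (i : Opt X) → F ≐ three (opt X i) 𝟎 Z → ThreeMove X Y Z F
  at-upper : (j : Opt Y) → F ≐ three X (opt Y j) Z → ThreeMove X Y Z F
  at-aside : (l : Opt Z) → F ≐ three X Y (opt Z l) → ThreeMove X Y Z F

three-move-view : ∀ {X Y Z F} → three X Y Z ⇒₃ F → ThreeMove X Y Z F
three-move-view (lower , i , at , above , other) = at-lower i
  λ { lower → at ; upper → above upper (lower≤upper , λ ()) ; aside → other aside (λ ()) (λ { (() , _) }) }
three-move-view (upper , j , at , above , other) = at-upper j
  λ { lower → other lower (λ ()) (λ { (() , _) }) ; upper → at ; aside → other aside (λ ()) (λ { (() , _) }) }
three-move-view (aside , l , at , above , other) = at-aside l
  λ { lower → other lower (λ ()) (λ { (() , _) }) ; upper → other upper (λ ()) (λ { (() , _) }) ; aside → at }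

move-lower : ∀ {X Y Z} i → three X Y Z ⇒₃ three (opt X i) 𝟎 Z
move-lower i = lower , i , refl
  , (λ { lower (_ , n) → ⊥-elim (n refl) ; upper _ → refl ; aside (() , _) })
  , (λ { lower n _ → ⊥-elim (n refl) ; upper _ l≮u → ⊥-elim (l≮u (lower≤upper , λ ())) ; aside _ _ → refl })

move-upper : ∀ {X Y Z} j → three X Y Z ⇒₃ three X (opt Y j) Z
move-upper j = upper , j , refl
  , (λ { lower (() , _) ; upper (_ , n) → ⊥-elim (n refl) ; aside (() , _) })
  , (λ { lower _ _ → refl ; upper n _ → ⊥-elim (n refl) ; aside _ _ → refl })

move-aside : ∀ {X Y Z} l → three X Y Z ⇒₃ three X Y (opt Z l)
move-aside l = aside , l , refl
  , (λ { lower (() , _) ; upper (() , _) ; aside (_ , n) → ⊥-elim (n refl) })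
  , (λ { lower _ _ → refl ; upper _ _ → refl ; aside n _ → ⊥-elim (n refl) })

mutual
  three-terminating : ∀ X Y Z → Terminating _⇒₃_ (three X Y Z)
  three-terminating X Y Z = acc λ m → ThreeMove-terminating X Y Z (three-move-view m)

  ThreeMove-terminating : ∀ X Y Z {F} → ThreeMove X Y Z F → Terminating _⇒₃_ F
  ThreeMove-terminating (mk I f) Y Z (at-lower i F≐) = Terminating-resp-≐ (≐-sym F≐) (three-terminating (f i) 𝟎 Z)
  ThreeMove-terminating X (mk K g) Z (at-upper j F≐) = Terminating-resp-≐ (≐-sym F≐) (three-terminating X (g j) Z)
  ThreeMove-terminating X Y (mk L h) (at-aside l F≐) = Terminating-resp-≐ (≐-sym F≐) (three-terminating X Y (h l))

module Separation (em : ExcludedMiddle (lsuc 0ℓ)) where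
  open Classical em

  mutual
    three-lose : ∀ X Y Z {γ δ} → IsGrundy (Chain X Y) γ → IsGrundy Z δ → γ ≈o δ → Lose _⇒₃_ (three X Y Z)
    three-lose X Y Z dXY dZ γ≈δ = lose λ F m → three-lose-moves X Y Z dXY dZ γ≈δ (three-move-view m)

    three-lose-moves : ∀ X Y Z {γ δ F} → IsGrundy (Chain X Y) γ → IsGrundy Z δ → γ ≈o δ →
      ThreeMove X Y Z F → Win _⇒₃_ F
    three-lose-moves (mk I f) (mk K g) Z (grundy v dv (∉ , _)) dZ γ≈δ (at-lower i F≐) =
      Win-resp-≐ (≐-sym F≐) (three-win (f i) 𝟎 Z (dv (inj₁ i)) dZ λ e → ∉ (inj₁ i) (≈o-trans e (≈o-sym γ≈δ)))
    three-lose-moves (mk I f) (mk K g) Z (grundy v dv (∉ , _)) dZ γ≈δ (at-upper j F≐) =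
      Win-resp-≐ (≐-sym F≐) (three-win (mk I f) (g j) Z (dv (inj₂ j)) dZ λ e → ∉ (inj₂ j) (≈o-trans e (≈o-sym γ≈δ)))
    three-lose-moves X Y (mk L h) dXY (grundy w dw (∉ , _)) γ≈δ (at-aside l F≐) =
      Win-resp-≐ (≐-sym F≐) (three-win X Y (h l) dXY (dw l) λ e → ∉ l (≈o-trans (≈o-sym e) γ≈δ))

    three-win : ∀ X Y Z {γ δ} → IsGrundy (Chain X Y) γ → IsGrundy Z δ → ¬ γ ≈o δ → Win _⇒₃_ (three X Y Z)
    three-win X Y Z {γ} {δ} dXY dZ γ≉δ with compare γ δ
    ... | inj₁ γ<δ = three-win-aside X Y Z dXY dZ γ<δ
    ... | inj₂ (inj₁ γ≈δ) = ⊥-elim (γ≉δ γ≈δ)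
    ... | inj₂ (inj₂ δ<γ) = three-win-chain X Y Z dXY dZ δ<γ

    three-win-aside : ∀ X Y Z {γ δ} → IsGrundy (Chain X Y) γ → IsGrundy Z δ → γ <o δ → Win _⇒₃_ (three X Y Z)
    three-win-aside X Y (mk L h) dXY (grundy w dw (_ , ∈)) γ<δ =
      let (l , e) = ∈ _ γ<δ in win _ (move-aside l) (three-lose X Y (h l) dXY (dw l) (≈o-sym e))

    three-win-chain : ∀ X Y Z {γ δ} → IsGrundy (Chain X Y) γ → IsGrundy Z δ → δ <o γ → Win _⇒₃_ (three X Y Z)
    three-win-chain (mk I f) (mk K g) Z (grundy v dv (_ , ∈)) dZ δ<γ with ∈ _ δ<γ
    ... | inj₁ i , e = win _ (move-lower i) (three-lose (f i) 𝟎 Z (dv (inj₁ i)) dZ e)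
    ... | inj₂ j , e = win _ (move-upper j) (three-lose (mk I f) (g j) Z (dv (inj₂ j)) dZ e)

  Chain-≉-option : ∀ X Y {γ α} i → IsGrundy (Chain X Y) γ → IsGrundy (opt X i) α → ¬ γ ≈o α
  Chain-≉-option (mk I f) (mk K g) i (grundy v dv (∉ , _)) dα γ≈α =
    ∉ (inj₁ i) (≈o-trans (IsGrundy-unique (dv (inj₁ i)) (Chain-𝟎 dα)) (≈o-sym γ≈α))

  _∉Γ₁_ : Ord → Game → Set
  α ∉Γ₁ H = ∀ j → ¬ (Γ₀ (opt H j) ≈o α)

  -- The options of Y realise exactly those option values of A that are
  -- missing from Γ₁(H); so Chain H Y has all values of options of A below α,
  -- and α is attained neither by H nor by A.
  realise : ∀ H {A α} → IsGrundy A α → α ∉Γ₁ H → Σ Game λ Y → IsGrundy (Chain H Y) α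
  realise H@(mk K h) {mk I g} (grundy v dv (∉ , ∈)) α∉ = Y , grundy value dvalue (∉Y , ∈Y)
    where
      missing? : (i : I) → Dec (v i ∉Γ₁ H)
      missing? i = decide₀ _

      Y : Game
      Y = mk (Σ I λ i → True (missing? i)) λ (i , m) → proj₁ (realise H (dv i) (toWitness m))

      value : Opt (Chain H Y) → Ord
      value (inj₁ k) = Γ₀ (h k)
      value (inj₂ (i , _)) = v i

      dvalue : ∀ o → IsGrundy (opt (Chain H Y) o) (value o)
      dvalue (inj₁ k) = Chain-𝟎 (Γ₀-isGrundy (h k))
      dvalue (inj₂ (i , m)) = proj₂ (realise H (dv i) (toWitness m))

      ∉Y : ∀ o → ¬ value o ≈o _
      ∉Y (inj₁ k) = α∉ k
      ∉Y (inj₂ (i , _)) = ∉ i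

      ∈Y : ∀ β → β <o _ → Σ (Opt (Chain H Y)) λ o → value o ≈o β
      ∈Y β β<α with ∈ β β<α
      ... | i , vi≈β with missing? i
      ...   | yes m = inj₂ (i , fromWitness m) , vi≈β
      ...   | no ¬m = let (k , e) = stable₀ λ ∄ → ¬m λ k e → ∄ (k , e) in inj₁ k , ≈o-trans e vi≈β

JoinIndistinguishable : Game → Game → Set₁
JoinIndistinguishable G H =
  (S : Set) (_≤_ : Rel S 0ℓ) → IsPartialOrder _≡_ _≤_ →
  (i₀ : S) (Gs Hs : S → Game) →
  Gs i₀ ≡ G → Hs i₀ ≡ H → (∀ i → i ≢ i₀ → Gs i ≡ Hs i) →
  Terminating (JoinMove _≤_) Gs → Terminating (JoinMove _≤_) Hs →
  SameOutcome (JoinMove _≤_) Gs Hs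

JoinIndistinguishable-sym : ∀ {G H} → JoinIndistinguishable G H → JoinIndistinguishable H G
JoinIndistinguishable-sym indist S _≤_ po i₀ Gs Hs Gs≡ Hs≡ agree tG tH =
  let ((l , l') , (w , w')) = indist S _≤_ po i₀ Hs Gs Hs≡ Gs≡ (λ i i≢i₀ → sym (agree i i≢i₀)) tH tG
  in (l' , l) , (w' , w)

module _ (em : ExcludedMiddle (lsuc 0ℓ)) where
  open Classical em
  open Separation em

  options-matched : ∀ G H → JoinIndistinguishable G H →
    ∀ i → Σ (Opt H) λ j → SameΓ₀ (opt G i) (opt H j)
  options-matched G H indist i = stable₁ λ unmatched →
    let (Y , dY) = realise H (Γ₀-isGrundy G') (α∉Γ₁H unmatched)
    in lose⇒¬win (G-side-loses Y dY) (G-side-wins Y)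
    where
      G' = opt G i
      α = Γ₀ G'

      α∉Γ₁H : ¬ (Σ (Opt H) λ j → SameΓ₀ G' (opt H j)) → α ∉Γ₁ H
      α∉Γ₁H unmatched j e =
        unmatched (j , α , Γ₀-isGrundy G' , IsGrundy-resp-≈o (Γ₀-isGrundy (opt H j)) e)

      agree : ∀ {Y} s → s ≢ lower → three G Y G' s ≡ three H Y G' s
      agree lower s≢lower = ⊥-elim (s≢lower refl)
      agree upper _ = refl
      agree aside _ = refl

      G-side-wins : ∀ Y → Win _⇒₃_ (three G Y G')
      G-side-wins Y = three-win G Y G' dGY (Γ₀-isGrundy G') (Chain-≉-option G Y i dGY (Γ₀-isGrundy G'))
        where dGY = Γ₀-isGrundy (Chain G Y)

      G-side-loses : ∀ Y → IsGrundy (Chain H Y) α → Lose _⇒₃_ (three G Y G')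
      G-side-loses Y dHY =
        let ((_ , H-loses⇒G-loses) , _) =
              indist Three _≤₃_ ≤₃-isPartialOrder lower (three G Y G') (three H Y G') refl refl agree
                     (three-terminating G Y G') (three-terminating H Y G')
        in H-loses⇒G-loses (three-lose H Y G' dHY (Γ₀-isGrundy G') ≈o-refl)

  JoinIndistinguishable⇒≃₁ : ∀ {G H} → JoinIndistinguishable G H → G ≃₁ H
  JoinIndistinguishable⇒≃₁ {G} {H} indist =
    options-matched G H indist ,
    λ j → let (i , s) = options-matched H G (JoinIndistinguishable-sym indist) j in i , SameΓ₀-sym s

theorem4p3 : ExcludedMiddle (lsuc 0ℓ) → (G H : Game) →
    (G ≃₁ H) ⇔
    ((S : Set) (_≤_ : Rel S 0ℓ) → IsPartialOrder _≡_ _≤_ →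
     (i₀ : S) (Gs Hs : S → Game) →
     Gs i₀ ≡ G → Hs i₀ ≡ H → (∀ i → i ≢ i₀ → Gs i ≡ Hs i) →
     Terminating (JoinMove _≤_) Gs → Terminating (JoinMove _≤_) Hs →
     SameOutcome (JoinMove _≤_) Gs Hs)
theorem4p3 em G H = mk⇔
  (λ G≃H S _≤_ _ i₀ Gs Hs Gs≡G Hs≡H agree →
     ≃₁⇒same-outcome em _≤_ i₀ (subst₂ _≃₁_ (sym Gs≡G) (sym Hs≡H) G≃H) agree)
  (JoinIndistinguishable⇒≃₁ em)
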